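{- Let $G$ be a finite group. If $G$ has an awning, then $rc(\Gamma_G^e)=2$.
   Context: Let $G$ be a finite group. The enhanced power graph $\Gamma_G^e$ has vertex set $G$, two distinct vertices $x,y$ being adjacent iff $x,y\in\langle z\rangle$ for some $z\in G$. For a connected graph $\Gamma$, an edge-colouring $\zeta:E(\Gamma)\to\{1,\dots,k\}$ (not necessarily proper) is a rainbow $k$-colouring if every pair of distinct vertices is joined by a path whose edges have pairwise distinct colours; $rc(\Gamma)$ is the minimum such $k$. An essential cyclic set $Max_G=\{x_1,\dots,x_m\}$ is a set of elements of $G$ such that $\langle x_1\rangle,\dots,\langle x_m\rangle$ are pairwise distinct and are exactly the maximal cyclic subgroups of $G$. Awning: given an ordering $x_1,\dots,x_m$ of $Max_G$, an awning is a family of indexed sets $H_1,\dots,H_{m-1}$, where $H_i=\{h_{i,i+1},\dots,h_{i,m}\}\subseteq\langle x_i\rangle$ is partitioned as $H_i=A_i\,\dot\cup\,B_i$, such that (1) $h_{i,j}\in\langle x_i\rangle\cap\langle x_j\rangle$ for all $i<j$; (2) whenever $i<j$, $2\le j\le m-1$, $s\in\{j+1,\dots,m\}$, $r\in\{i+1,\dots,m\}$ and $h_{j,s}=h_{i,r}$: (a) if $r=j$ and $h_{i,r}\in A_i$ then $h_{j,s}\in B_j$; (b) if $r=j$ and $h_{i,r}\in B_i$ then $h_{j,s}\in A_j$; (c) if $r=s>j$ and $h_{i,r}\in A_i$ then $h_{j,r}\in A_j$; (d) if $r=s>j$ and $h_{i,r}\in B_i$ then $h_{j,r}\in B_j$.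 $G$ has an awning if an awning exists for some ordering of $Max_G$. -}

module Defs where

open import Level using (0ℓ)
open import Data.Nat using (ℕ; zero; suc)
open import Data.Fin using (Fin) renaming (_<_ to _<ᶠ_)
open import Data.Bool using (Bool; true; false)
open import Data.List using (List; []; _∷_)
open import Data.List.Relation.Unary.Unique.Propositional using (Unique)
open import Data.Product using (Σ; ∃; _×_; _,_)
open import Relation.Binary.PropositionalEquality using (_≡_; _≢_)
open import Relation.Nullary using (¬_)
open import Algebra.Structures using (IsGroup)

-- Finite groups: a group whose underlying set is Fin order
-- (every finite group is isomorphic to one of this form).

record FiniteGroup : Set where
  field
    order   : ℕ
    _∙_     : Fin order → Fin order → Fin order
    ε       : Fin order
    _⁻¹     : Fin order → Fin order
    isGroup : IsGroup _≡_ _∙_ ε _⁻¹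

module _ (G : FiniteGroup) where
  open FiniteGroup G

  Elt : Set
  Elt = Fin order

  pow : Elt → ℕ → Elt
  pow g zero    = ε
  pow g (suc k) = g ∙ pow g k

  -- x ∈ ⟨z⟩  (in a finite group ⟨z⟩ = {z^k | k ∈ ℕ})
  _∈⟨_⟩ : Elt → Elt → Set
  x ∈⟨ z ⟩ = ∃ λ (k : ℕ) → pow z k ≡ x

  _⊆⟨⟩_ : Elt → Elt → Set
  x ⊆⟨⟩ y = ∀ g → g ∈⟨ x ⟩ → g ∈⟨ y ⟩

  _≡⟨⟩_ : Elt → Elt → Set
  x ≡⟨⟩ y = (x ⊆⟨⟩ y) × (y ⊆⟨⟩ x)

  IsCyclic : Set
  IsCyclic = ∃ λ (g : Elt) → ∀ x → x ∈⟨ g ⟩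

  MaximalCyclic : Elt → Set
  MaximalCyclic x = ∀ y → x ⊆⟨⟩ y → x ≡⟨⟩ y

  IsEssentialCyclicSet : (m : ℕ) → (Fin m → Elt) → Set
  IsEssentialCyclicSet m x =
      (∀ i j → i ≢ j → ¬ (x i ≡⟨⟩ x j))
    × (∀ i → MaximalCyclic (x i))
    × (∀ y → MaximalCyclic y → ∃ λ i → y ≡⟨⟩ x i)

  -- An awning for the ordering x₀,…,x_{m-1} (0-based indices).
  -- h i j  is h_{i,j} (only meaningful for i < j);
  -- inA i g ≡ true  means  g ∈ A_i,  and for g ∈ H_i,
  -- inA i g ≡ false means  g ∈ B_i = H_i ∖ A_i.
  IsAwning : (m : ℕ) → (Fin m → Elt) →
             (h : Fin m → Fin m → Elt) → (inA : Fin m → Elt → Bool) → Set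
  IsAwning m x h inA =
      (∀ i j → i <ᶠ j → (h i j ∈⟨ x i ⟩) × (h i j ∈⟨ x j ⟩))
    × (∀ i j s r → i <ᶠ j → j <ᶠ s → i <ᶠ r → h j s ≡ h i r →
          (r ≡ j → inA i (h i r) ≡ true  → inA j (h j s) ≡ false)
        × (r ≡ j → inA i (h i r) ≡ false → inA j (h j s) ≡ true)
        × (r ≡ s → inA i (h i r) ≡ true  → inA j (h j r) ≡ true)
        × (r ≡ s → inA i (h i r) ≡ false → inA j (h j r) ≡ false))

  HasAwning : Set
  HasAwning = ∃ λ (m : ℕ) → Σ (Fin m → Elt) λ x →
    IsEssentialCyclicSet m x ×
    (∃ λ (h : Fin m → Fin m → Elt) → ∃ λ (inA : Fin m → Elt → Bool) →
      IsAwning m x h inA)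

  EPAdj : Elt → Elt → Set
  EPAdj x y = (x ≢ y) × (∃ λ z → (x ∈⟨ z ⟩) × (y ∈⟨ z ⟩))

module _ {n : ℕ} (Adj : Fin n → Fin n → Set) where

  record EdgeColouring (k : ℕ) : Set where
    field
      colour : ∀ x y → Adj x y → Fin k
      sym    : ∀ x y (p : Adj x y) (q : Adj y x) → colour x y p ≡ colour y x q

  data Walk : Fin n → Fin n → Set where
    []  : ∀ {x} → Walk x x
    _∷_ : ∀ {x y z} → Adj x y → Walk y z → Walk x z

  vertices : ∀ {x y} → Walk x y → List (Fin n)
  vertices {x} []      = x ∷ []
  vertices {x} (_ ∷ w) = x ∷ vertices w

  colours : ∀ {k x y} → EdgeColouring k → Walk x y → List (Fin k)
  colours c []                  = []
  colours {x = x} c (_∷_ {y = y} e w) =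
    EdgeColouring.colour c x y e ∷ colours c w

  IsRainbowPath : ∀ {k x y} → EdgeColouring k → Walk x y → Set
  IsRainbowPath c w = Unique (vertices w) × Unique (colours c w)

  IsRainbowColouring : ∀ {k} → EdgeColouring k → Set
  IsRainbowColouring c =
    ∀ x y → x ≢ y → Σ (Walk x y) λ w → IsRainbowPath c w

  HasRainbowColouring : ℕ → Set
  HasRainbowColouring k = Σ (EdgeColouring k) IsRainbowColouring

  RainbowConnectionNumberIs : ℕ → Set
  RainbowConnectionNumberIs k =
    HasRainbowColouring k × (∀ k′ → k′ Data.Nat.< k → ¬ HasRainbowColouring k′)

module Submission where

-- In a finite group every element lies in a maximal cyclic
-- subgroup (climb along strictly larger cyclic subgroups; this terminates
-- because strict inclusion of subsets of G is well founded).  If G is not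
-- cyclic, two distinct maximal cyclic subgroups ⟨w⟩, ⟨w′⟩ exist, and w, w′
-- are non-adjacent; a rainbow path between them has at least two edges, so
-- it needs two colours.
--
-- Let x₀,…,x_{m-1} be the ordered essential cyclic set carrying
-- the awning.  Every u has a home: the least i with u ∈ ⟨xᵢ⟩.  The awning
-- gives each u a side (A or B) in every row or column k of the index grid it
-- occurs in, and the awning axioms make this label well defined.  An edge
-- {u,v} with home u ≤ home v is coloured by whether the side of u at index
-- home v differs from its side at its own home.  Vertices sharing some ⟨xᵢ⟩
-- are adjacent; otherwise, for i = home u < j = home v, the path
-- u — h_{i,j} — v is rainbow, since h_{i,j} lies on opposite sides in row i
-- and column j.

open import Defs
open import Level using (0ℓ)
open import Data.Nat as ℕ using (ℕ; zero; suc; _+_; _*_; _∸_; z≤n; s≤s)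
import Data.Nat.Properties as ℕP
open import Data.Nat.DivMod using (_%_; _/_; m≡m%n+[m/n]*n; m%n<n)
open import Data.Fin as F using (Fin; toℕ; _≟_)
open import Data.Fin.Properties
  using (any?; all?; pigeonhole; ¬∀⟶∃¬; _<?_; _≤?_; <-cmp; ≤-total; ≤-antisym;
         toℕ<n; toℕ-fromℕ<)
open import Data.Fin.Subset using (Subset; _⊃_) renaming (_∈_ to _∈ˢ_)
open import Data.Fin.Subset.Properties using (_⊂?_)
open import Data.Fin.Subset.Induction using (⊃-wellFounded)
open import Data.Vec using (tabulate)
open import Data.Vec.Properties using (lookup∘tabulate; []=⇒lookup; lookup⇒[]=)
open import Data.Bool using (Bool; true; false; not; _xor_)
open import Data.Bool.Properties using (xor-same; not-distribˡ-xor; not-¬)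
open import Data.Product using (Σ; ∃; _×_; _,_; proj₁; proj₂)
open import Data.Sum using (inj₁; inj₂)
open import Data.Empty using (⊥-elim)
open import Data.List.Relation.Unary.All using ([]; _∷_)
open import Data.List.Relation.Unary.AllPairs using ([]; _∷_)
open import Relation.Nullary using (¬_; Dec; yes; no; does)
open import Relation.Nullary.Decidable using (_×-dec_; dec-true; dec-false; decidable-stable)
open import Relation.Binary.Definitions using (tri<; tri≈; tri>)
open import Relation.Binary.PropositionalEquality
open import Induction.WellFounded using (Acc; acc)
open import Algebra.Bundles using (Group)
open import Algebra.Structures using (IsGroup)
import Algebra.Properties.Group as GroupProperties

-- Two Booleans related by implications on both values are equal, resp.
-- complementary; this is how the awning axioms (stated per value) are used.
sameBool : ∀ {a b} → (a ≡ true → b ≡ true) → (a ≡ false → b ≡ false) → b ≡ a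
sameBool {true}  t _ = t refl
sameBool {false} _ f = f refl

oppositeBool : ∀ {a b} → (a ≡ true → b ≡ false) → (a ≡ false → b ≡ true) → b ≡ not a
oppositeBool {true}  t _ = t refl
oppositeBool {false} _ f = f refl

leastWitness : ∀ {m} (P : Fin m → Set) → (∀ i → Dec (P i)) → ∃ P →
               Σ (Fin m) λ i → P i × (∀ j → P j → i F.≤ j)
leastWitness {suc m} P P? witness with P? F.zero
... | yes P0 = F.zero , P0 , λ _ _ → z≤n
... | no ¬P0 with witness
...   | F.zero , P0 = ⊥-elim (¬P0 P0)
...   | F.suc i , Pi with leastWitness (λ j → P (F.suc j)) (λ j → P? (F.suc j)) (i , Pi)
...     | k , Pk , least = F.suc k , Pk , λ
          { F.zero P0 → ⊥-elim (¬P0 P0)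
          ; (F.suc j) Pj → s≤s (least j Pj) }

module RainbowPaths {n : ℕ} (Adj : Fin n → Fin n → Set) where

  toFin2 : Bool → Fin 2
  toFin2 true  = F.suc F.zero
  toFin2 false = F.zero

  toFin2-injective : ∀ {a b} → toFin2 a ≡ toFin2 b → a ≡ b
  toFin2-injective {true}  {true}  _ = refl
  toFin2-injective {false} {false} _ = refl
  toFin2-injective {true}  {false} ()
  toFin2-injective {false} {true}  ()

  boolColouring : (c : Fin n → Fin n → Bool) → (∀ u v → c u v ≡ c v u) →
                  EdgeColouring Adj 2
  boolColouring c c-sym = record
    { colour = λ u v _ → toFin2 (c u v)
    ; sym    = λ u v _ _ → cong toFin2 (c-sym u v) }

  oneEdge : ∀ {k} (c : EdgeColouring Adj k) {u v} → u ≢ v → Adj u v →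
            Σ (Walk Adj u v) (IsRainbowPath Adj c)
  oneEdge c u≢v e = (e ∷ []) , ((u≢v ∷ []) ∷ [] ∷ []) , ([] ∷ [])

  twoEdges : ∀ {k} (c : EdgeColouring Adj k) {u w v} →
             u ≢ v → u ≢ w → w ≢ v → (e₁ : Adj u w) (e₂ : Adj w v) →
             EdgeColouring.colour c u w e₁ ≢ EdgeColouring.colour c w v e₂ →
             Σ (Walk Adj u v) (IsRainbowPath Adj c)
  twoEdges c u≢v u≢w w≢v e₁ e₂ differ =
    (e₁ ∷ (e₂ ∷ [])) ,
    ((u≢w ∷ u≢v ∷ []) ∷ (w≢v ∷ []) ∷ [] ∷ []) ,
    ((differ ∷ []) ∷ [] ∷ [])

  atMostOneColour : ∀ {k} → k ℕ.< 2 → (a b : Fin k) → a ≡ b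
  atMostOneColour {suc zero} _ F.zero F.zero = refl
  atMostOneColour {suc (suc _)} (s≤s (s≤s ()))

  -- Two distinct non-adjacent vertices force at least two colours: any path
  -- joining them has two edges, which a single colour cannot distinguish.
  needsTwoColours : ∀ {u v} → u ≢ v → ¬ Adj u v →
                    ∀ k → k ℕ.< 2 → ¬ HasRainbowColouring Adj k
  needsTwoColours {u} {v} u≢v ¬adj k k<2 (c , rainbow) with rainbow u v u≢v
  ... | [] , _ = u≢v refl
  ... | (e ∷ []) , _ = ¬adj e
  ... | (_ ∷ _ ∷ _) , _ , ((differ ∷ _) ∷ _) = differ (atMostOneColour k<2 _ _)

module _ (G : FiniteGroup) where
  open FiniteGroup G
  open IsGroup isGroup using (assoc; identityˡ; identityʳ)

  private
    group : Group 0ℓ 0ℓ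
    group = record
      { Carrier = Elt G ; _≈_ = _≡_ ; _∙_ = _∙_ ; ε = ε ; _⁻¹ = _⁻¹ ; isGroup = isGroup }
  open GroupProperties group using (∙-cancelˡ)

  infixr 30 _^_
  infix 4 _∈⟦_⟧

  _^_ : Elt G → ℕ → Elt G
  g ^ k = pow G g k

  _∈⟦_⟧ : Elt G → Elt G → Set
  g ∈⟦ z ⟧ = _∈⟨_⟩ G g z

  ^-+ : ∀ g a b → g ^ (a + b) ≡ g ^ a ∙ g ^ b
  ^-+ g zero    b = sym (identityˡ _)
  ^-+ g (suc a) b = trans (cong (g ∙_) (^-+ g a b)) (sym (assoc _ _ _))

  ^-* : ∀ g a b → (g ^ a) ^ b ≡ g ^ (b * a)
  ^-* g a zero    = refl
  ^-* g a (suc b) = trans (cong (g ^ a ∙_) (^-* g a b)) (sym (^-+ g a (b * a)))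

  ε^ : ∀ k → ε ^ k ≡ ε
  ε^ zero    = refl
  ε^ (suc k) = trans (cong (ε ∙_) (ε^ k)) (identityˡ ε)

  ∈-refl : ∀ g → g ∈⟦ g ⟧
  ∈-refl g = 1 , identityʳ g

  ∈-trans : ∀ {g y z} → g ∈⟦ y ⟧ → y ∈⟦ z ⟧ → g ∈⟦ z ⟧
  ∈-trans {z = z} (a , refl) (b , refl) = a * b , sym (^-* z b a)

  -- Every element has a period 1 ≤ p ≤ |G|: by pigeonhole two of the powers
  -- z⁰,…,z^|G| coincide, z^i = z^(i+p), and cancelling z^i gives z^p = ε.
  period : ∀ z → ∃ λ d → suc d ℕ.≤ order × z ^ suc d ≡ ε
  period z with pigeonhole (ℕP.n<1+n order) (λ t → z ^ toℕ t)
  ... | i , j , i<j , zi≡zj = d , d<order , ∙-cancelˡ (z ^ toℕ i) _ _ shifted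
    where
      open ≡-Reasoning
      d = toℕ j ∸ suc (toℕ i)
      i+p≡j : toℕ i + suc d ≡ toℕ j
      i+p≡j = trans (ℕP.+-suc (toℕ i) d) (ℕP.m+[n∸m]≡n i<j)
      d<order : suc d ℕ.≤ order
      d<order = ℕP.≤-trans (ℕP.m≤n+m (suc d) (toℕ i))
                  (ℕP.≤-trans (ℕP.≤-reflexive i+p≡j)
                    (ℕP.≤-pred (toℕ<n j)))
      shifted : z ^ toℕ i ∙ z ^ suc d ≡ z ^ toℕ i ∙ ε
      shifted = begin
        z ^ toℕ i ∙ z ^ suc d  ≡⟨ sym (^-+ z (toℕ i) (suc d)) ⟩
        z ^ (toℕ i + suc d)    ≡⟨ cong (z ^_) i+p≡j ⟩
        z ^ toℕ j              ≡⟨ sym zi≡zj ⟩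
        z ^ toℕ i              ≡⟨ sym (identityʳ _) ⟩
        z ^ toℕ i ∙ ε          ∎

  smallExponent : ∀ z k → Σ (Fin order) λ t → z ^ toℕ t ≡ z ^ k
  smallExponent z k with period z
  ... | d , p≤order , zp≡ε =
        F.fromℕ< r<order
      , trans (cong (z ^_) (toℕ-fromℕ< r<order)) (sym reduce)
    where
      open ≡-Reasoning
      p = suc d
      r<order : k % p ℕ.< order
      r<order = ℕP.<-≤-trans (m%n<n k p) p≤order
      reduce : z ^ k ≡ z ^ (k % p)
      reduce = begin
        z ^ k                             ≡⟨ cong (z ^_) (m≡m%n+[m/n]*n k p) ⟩
        z ^ (k % p + (k / p) * p)         ≡⟨ ^-+ z (k % p) ((k / p) * p) ⟩
        z ^ (k % p) ∙ z ^ ((k / p) * p)   ≡⟨ cong (z ^ (k % p) ∙_) (sym (^-* z p (k / p))) ⟩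
        z ^ (k % p) ∙ (z ^ p) ^ (k / p)   ≡⟨ cong (λ y → z ^ (k % p) ∙ y ^ (k / p)) zp≡ε ⟩
        z ^ (k % p) ∙ ε ^ (k / p)         ≡⟨ cong (z ^ (k % p) ∙_) (ε^ (k / p)) ⟩
        z ^ (k % p) ∙ ε                   ≡⟨ identityʳ _ ⟩
        z ^ (k % p)                       ∎

  -- Membership in a cyclic subgroup is decidable: search the exponents < |G|.
  _∈?_ : ∀ g z → Dec (g ∈⟦ z ⟧)
  g ∈? z with any? (λ (t : Fin order) → z ^ toℕ t ≟ g)
  ... | yes (t , e) = yes (toℕ t , e)
  ... | no none = no λ { (k , e) →
          let (t , e′) = smallExponent z k in none (t , trans e′ e) }

  ⟪_⟫ : Elt G → Subset order
  ⟪ z ⟫ = tabulate (λ g → does (g ∈? z))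

  ⟪⟫-complete : ∀ {g z} → g ∈⟦ z ⟧ → g ∈ˢ ⟪ z ⟫
  ⟪⟫-complete {g} {z} g∈z =
    lookup⇒[]= g ⟪ z ⟫ (trans (lookup∘tabulate _ g) (dec-true (g ∈? z) g∈z))

  ⟪⟫-sound : ∀ {g z} → g ∈ˢ ⟪ z ⟫ → g ∈⟦ z ⟧
  ⟪⟫-sound {g} {z} g∈ˢz = decidable-stable (g ∈? z) λ g∉z → true≢false
    (trans (sym ([]=⇒lookup g∈ˢz)) (trans (lookup∘tabulate _ g) (dec-false (g ∈? z) g∉z)))
    where
      true≢false : true ≢ false
      true≢false ()

  -- Climb to a maximal cyclic subgroup: while some ⟨w⟩ strictly contains
  -- ⟨y⟩, move to w.  Strict inclusion of subsets of G is well founded.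
  climb : ∀ y → Acc _⊃_ ⟪ y ⟫ → Σ (Elt G) λ w → MaximalCyclic G w × y ∈⟦ w ⟧
  climb y (acc larger) with any? (λ w → ⟪ y ⟫ ⊂? ⟪ w ⟫)
  ... | yes (w , y⊂w) =
        let (v , v-max , w∈v) = climb w (larger y⊂w)
        in v , v-max , ∈-trans (⟪⟫-sound (proj₁ y⊂w (⟪⟫-complete (∈-refl y)))) w∈v
  ... | no noLarger = y , y-max , ∈-refl y
    where
      y-max : MaximalCyclic G y
      y-max w y⊆w = y⊆w , λ g g∈w → decidable-stable (g ∈? y) λ g∉y →
        noLarger (w , (λ h∈y → ⟪⟫-complete (y⊆w _ (⟪⟫-sound h∈y)))
                    , g , ⟪⟫-complete g∈w , λ g∈y → g∉y (⟪⟫-sound g∈y))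

  maximalAbove : ∀ g → Σ (Elt G) λ w → MaximalCyclic G w × g ∈⟦ w ⟧
  maximalAbove g = climb g (⊃-wellFounded ⟪ g ⟫)

  -- A non-cyclic group has two distinct maximal cyclic subgroups ⟨w⟩, ⟨w′⟩;
  -- their generators are not adjacent, since a common ⟨z⟩ would equal both.
  distantPair : ¬ IsCyclic G → Σ (Elt G) λ w → Σ (Elt G) λ w′ → w ≢ w′ × ¬ EPAdj G w w′
  distantPair noncyclic with maximalAbove ε
  ... | w , w-max , _ with all? (_∈? w)
  ...   | yes everything = ⊥-elim (noncyclic (w , everything))
  ...   | no ¬everything with ¬∀⟶∃¬ order _ (_∈? w) ¬everything
  ...     | g , g∉w with maximalAbove g
  ...       | w′ , _ , g∈w′ = w , w′ , w≢w′ , apart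
    where
      w≢w′ : w ≢ w′
      w≢w′ refl = g∉w g∈w′
      apart : ¬ EPAdj G w w′
      apart (_ , z , w∈z , w′∈z) =
        g∉w (proj₂ (w-max z (λ _ h∈w → ∈-trans h∈w w∈z)) g (∈-trans g∈w′ w′∈z))

  essentialCover : ∀ {m} {x : Fin m → Elt G} → IsEssentialCyclicSet G m x →
                   ∀ g → ∃ λ i → g ∈⟦ x i ⟧
  essentialCover (_ , _ , complete) g with maximalAbove g
  ... | w , w-max , g∈w with complete w w-max
  ...   | i , (w⊆xᵢ , _) = i , w⊆xᵢ g g∈w

  module AwningColouring {m : ℕ} (x : Fin m → Elt G) (cover : ∀ g → ∃ λ i → g ∈⟦ x i ⟧)
                         (h : Fin m → Fin m → Elt G) (inA : Fin m → Elt G → Bool)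
                         (awning : IsAwning G m x h inA) where
    open RainbowPaths (EPAdj G)

    meet : ∀ {i j} → i F.< j → h i j ∈⟦ x i ⟧ × h i j ∈⟦ x j ⟧
    meet = proj₁ awning _ _

    rowFlip : ∀ {i j s} → i F.< j → j F.< s → h j s ≡ h i j →
              inA j (h j s) ≡ not (inA i (h i j))
    rowFlip i<j j<s e =
      let (toB , toA , _ , _) = proj₂ awning _ _ _ _ i<j j<s i<j e in oppositeBool (toB refl) (toA refl)

    columnAgree : ∀ {i j r} → i F.< j → j F.< r → h j r ≡ h i r →
                  inA j (h j r) ≡ inA i (h i r)
    columnAgree i<j j<r e =
      let (_ , _ , keepA , keepB) = proj₂ awning _ _ _ _ i<j j<r (ℕP.<-trans i<j j<r) e
      in sameBool (keepA refl) (keepB refl)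

    homeWitness : ∀ g → Σ (Fin m) λ i → g ∈⟦ x i ⟧ × (∀ j → g ∈⟦ x j ⟧ → i F.≤ j)
    homeWitness g = leastWitness (λ i → g ∈⟦ x i ⟧) (λ i → g ∈? x i) (cover g)

    home : Elt G → Fin m
    home g = proj₁ (homeWitness g)

    home-∈ : ∀ g → g ∈⟦ x (home g) ⟧
    home-∈ g = proj₁ (proj₂ (homeWitness g))

    home-least : ∀ g {j} → g ∈⟦ x j ⟧ → home g F.≤ j
    home-least g = proj₂ (proj₂ (homeWitness g)) _

    label : Elt G → Fin m → Bool
    label u k with any? (λ r → (k <? r) ×-dec (h k r ≟ u))
    ... | yes _ = inA k u
    ... | no _ with any? (λ i → (i <? k) ×-dec (h i k ≟ u))
    ...   | yes (i , _) = not (inA i u)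
    ...   | no _ = false

    label-row : ∀ {k r} → k F.< r → label (h k r) k ≡ inA k (h k r)
    label-row {k} {r} k<r with any? (λ r′ → (k <? r′) ×-dec (h k r′ ≟ h k r))
    ... | yes _ = refl
    ... | no none = ⊥-elim (none (r , k<r , refl))

    sameSide : ∀ {i i′ k} → i F.< k → i′ F.< k → h i′ k ≡ h i k →
               inA i′ (h i k) ≡ inA i (h i k)
    sameSide {i} {i′} i<k i′<k e with <-cmp i i′
    ... | tri≈ _ refl _ = refl
    ... | tri< i<i′ _ _ = trans (cong (inA i′) (sym e)) (columnAgree i<i′ i′<k e)
    ... | tri> _ _ i′<i = sym (trans (columnAgree i′<i i<k (sym e)) (cong (inA i′) e))

    -- The label is well defined on columns: this is where the awning axioms enter.
    label-column : ∀ {i k} → i F.< k → label (h i k) k ≡ not (inA i (h i k))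
    label-column {i} {k} i<k with any? (λ r → (k <? r) ×-dec (h k r ≟ h i k))
    ... | yes (r , k<r , e) = trans (cong (inA k) (sym e)) (rowFlip i<k k<r e)
    ... | no _ with any? (λ i′ → (i′ <? k) ×-dec (h i′ k ≟ h i k))
    ...   | yes (i′ , i′<k , e) = cong not (sameSide i<k i′<k e)
    ...   | no none = ⊥-elim (none (i , i<k , refl))

    tint : Elt G → Fin m → Bool
    tint u k = label u k xor label u (home u)

    colour : Elt G → Elt G → Bool
    colour u v with home u ≤? home v
    ... | yes _ = tint u (home v)
    ... | no _  = tint v (home u)

    colour-≤ : ∀ {u v} → home u F.≤ home v → colour u v ≡ tint u (home v)
    colour-≤ {u} {v} u≤v with home u ≤? home v
    ... | yes _ = refl
    ... | no u≰v = ⊥-elim (u≰v u≤v)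

    -- When the homes coincide both candidate colours are false.
    colour-≥ : ∀ {u v} → home v F.≤ home u → colour u v ≡ tint v (home u)
    colour-≥ {u} {v} v≤u with home u ≤? home v
    ... | no _ = refl
    ... | yes u≤v = begin
        tint u (home v)  ≡⟨ cong (tint u) (sym same) ⟩
        tint u (home u)  ≡⟨ xor-same (label u (home u)) ⟩
        false            ≡⟨ sym (xor-same (label v (home v))) ⟩
        tint v (home v)  ≡⟨ cong (tint v) (sym same) ⟩
        tint v (home u)  ∎
      where
        open ≡-Reasoning
        same : home u ≡ home v
        same = ≤-antisym u≤v v≤u

    colour-sym : ∀ u v → colour u v ≡ colour v u
    colour-sym u v with ≤-total (home u) (home v)
    ... | inj₁ u≤v = trans (colour-≤ u≤v) (sym (colour-≥ u≤v))
    ... | inj₂ v≤u = trans (colour-≥ v≤u) (sym (colour-≤ v≤u))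

    -- The heart of the proof: for home u < home v the two edges of the path
    -- u — h_{home u, home v} — v get different colours, because the middle
    -- vertex lies on opposite sides in row home u and column home v.
    bridge : ∀ {u v} → (lt : home u F.< home v) →
             colour u (h (home u) (home v)) ≢ colour (h (home u) (home v)) v
    bridge {u} {v} lt = λ e → not-¬ refl (trans (sym first) (trans e second))
      where
        i j : Fin m
        i = home u
        j = home v
        w : Elt G
        w = h i j
        own : Bool
        own = label w (home w)
        w≤i : home w F.≤ i
        w≤i = home-least w (proj₁ (meet lt))
        first : colour u w ≡ inA i w xor own
        first = trans (colour-≥ w≤i) (cong (_xor own) (label-row lt))
        second : colour w v ≡ not (inA i w xor own)
        second = begin
          colour w v               ≡⟨ colour-≤ (ℕP.<⇒≤ (ℕP.≤-<-trans w≤i lt)) ⟩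
          label w j xor own        ≡⟨ cong (_xor own) (label-column lt) ⟩
          not (inA i w) xor own    ≡⟨ sym (not-distribˡ-xor (inA i w) own) ⟩
          not (inA i w xor own)    ∎
          where open ≡-Reasoning

    awningColouring : EdgeColouring (EPAdj G) 2
    awningColouring = boolColouring colour colour-sym

    Apart : Elt G → Elt G → Set
    Apart u v = ¬ (∃ λ i → u ∈⟦ x i ⟧ × v ∈⟦ x i ⟧)

    -- A vertex w sharing ⟨x_a⟩ with u and ⟨x_b⟩ with v yields a rainbow path
    -- when the two edges differ in colour; w differs from u and v as they are apart.
    detour : ∀ {u v w a b} → u ≢ v → Apart u v →
             u ∈⟦ x a ⟧ → w ∈⟦ x a ⟧ → w ∈⟦ x b ⟧ → v ∈⟦ x b ⟧ →
             colour u w ≢ colour w v →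
             Σ (Walk (EPAdj G) u v) (IsRainbowPath (EPAdj G) awningColouring)
    detour {u} {v} {w} {a} {b} u≢v apart u∈a w∈a w∈b v∈b differ =
      twoEdges awningColouring u≢v u≢w w≢v
        (u≢w , x a , u∈a , w∈a) (w≢v , x b , w∈b , v∈b) (λ e → differ (toFin2-injective e))
      where
        u≢w : u ≢ w
        u≢w refl = apart (b , w∈b , v∈b)
        w≢v : w ≢ v
        w≢v refl = apart (a , u∈a , w∈a)

    awningRainbow : IsRainbowColouring (EPAdj G) awningColouring
    awningRainbow u v u≢v with any? (λ i → (u ∈? x i) ×-dec (v ∈? x i))
    ... | yes (i , u∈ , v∈) = oneEdge awningColouring u≢v (u≢v , x i , u∈ , v∈)
    ... | no apart with <-cmp (home u) (home v)
    ...   | tri≈ _ same _ = ⊥-elim (apart (home u , home-∈ u , subst (λ i → v ∈⟦ x i ⟧) (sym same) (home-∈ v)))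
    ...   | tri< u<v _ _ =
            detour u≢v apart (home-∈ u) (proj₁ (meet u<v)) (proj₂ (meet u<v)) (home-∈ v) (bridge u<v)
    ...   | tri> _ _ v<u =
            detour u≢v apart (home-∈ u) (proj₂ (meet v<u)) (proj₁ (meet v<u)) (home-∈ v)
              (λ e → bridge v<u (trans (colour-sym v _) (trans (sym e) (colour-sym u _))))

proposition2p14 : (G : FiniteGroup) → ¬ IsCyclic G → HasAwning G →
    RainbowConnectionNumberIs (EPAdj G) 2
proposition2p14 G noncyclic (m , x , essential , h , inA , awning)
  with distantPair G noncyclic
... | w , w′ , w≢w′ , apart =
  (awningColouring , awningRainbow) , needsTwoColours w≢w′ apart
  where
    open AwningColouring G x (essentialCover G essential) h inA awning
    open RainbowPaths (EPAdj G) using (needsTwoColours)
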